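{- Let $G=K_{l_1*t_1,\dots,l_s*t_s}$ with $t_1>\cdots>t_s\ge 1$, $l_i\ge 1$, and for each $i$ let $U_{i,1},\dots,U_{i,l_i}$ be the $l_i$ parts of size $t_i$. Then: (1) $-t_i$ is an eigenvalue of $G$ with multiplicity at least $l_i-1$; (2) suppose $l_i\ge 2$, let $j\neq k$ in $\{1,\dots,l_i\}$, and let $G^\sigma$ be the switching of $G$ about a vertex set $X$ with $|X\cap U_{i,j}|=p$ and $|X\cap U_{i,k}|=q$, where $1\le p\le t_i$ and $0\le q<p$. Then the eigenvalue $-t_i$ of $G^\sigma$ is main.
   Context: $K_{l_1*t_1,\dots,l_s*t_s}$ is the complete multipartite graph with, for each $i$, exactly $l_i$ parts of size $t_i$. The switching of $G$ about $X$ is the signed graph in which exactly the edges between $X$ and $V(G)\setminus X$ are negative; its eigenvalues are those of its signed adjacency matrix. An eigenvalue is main if it has an eigenvector whose entries have nonzero sum. -}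

module Defs where

open import Data.Nat as ℕ using (ℕ; zero; suc)
open import Data.Fin using (Fin; toℕ)
open import Data.Bool using (Bool; true; false; if_then_else_; _xor_; _∧_)
open import Data.Product using (Σ; _×_; _,_; ∃)
open import Data.Integer using (+_)
open import Data.Rational using (ℚ; 0ℚ; 1ℚ; _+_; _*_; -_; _/_)
open import Relation.Binary.PropositionalEquality using (_≡_; _≢_)
open import Relation.Nullary.Decidable using (⌊_⌋)

sumFin : (n : ℕ) → (Fin n → ℚ) → ℚ
sumFin zero    f = 0ℚ
sumFin (suc n) f = f Data.Fin.zero + sumFin n (λ a → f (Data.Fin.suc a))

countFin : (n : ℕ) → (Fin n → Bool) → ℕ
countFin zero    P = 0
countFin (suc n) P = (if P Data.Fin.zero then 1 else 0) ℕ.+ countFin n (λ a → P (Data.Fin.suc a))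

-- Vertex set of K_{l_1*t_1,...,l_s*t_s}: a vertex (i , j , a) is the a-th
-- vertex of the part U_{i,j}, the j-th of the l_i parts of size t_i.
Vertex : (s : ℕ) (l t : Fin s → ℕ) → Set
Vertex s l t = Σ (Fin s) (λ i → Fin (l i) × Fin (t i))

sumV : (s : ℕ) (l t : Fin s → ℕ) → (Vertex s l t → ℚ) → ℚ
sumV s l t f = sumFin s (λ i → sumFin (l i) (λ j → sumFin (t i) (λ a → f (i , j , a))))

samePart : {s : ℕ} {l t : Fin s → ℕ} → Vertex s l t → Vertex s l t → Bool
samePart (i , j , _) (i' , j' , _) = ⌊ toℕ i ℕ.≟ toℕ i' ⌋ ∧ ⌊ toℕ j ℕ.≟ toℕ j' ⌋

adj : (s : ℕ) (l t : Fin s → ℕ) → Vertex s l t → Vertex s l t → ℚ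
adj s l t u v = if samePart u v then 0ℚ else 1ℚ

switching : {V : Set} → (V → V → ℚ) → (V → Bool) → V → V → ℚ
switching A X u v = if X u xor X v then - A u v else A u v

IsEigen : (s : ℕ) (l t : Fin s → ℕ) → (Vertex s l t → Vertex s l t → ℚ) → ℚ → (Vertex s l t → ℚ) → Set
IsEigen s l t A μ x = ∀ u → sumV s l t (λ v → A u v * x v) ≡ μ * x u

-- μ is an eigenvalue of A with multiplicity at least m: there are m linearly
-- independent eigenvectors for μ (A symmetric, so geometric = algebraic multiplicity).
MultAtLeast : (s : ℕ) (l t : Fin s → ℕ) → (Vertex s l t → Vertex s l t → ℚ) → ℚ → ℕ → Set
MultAtLeast s l t A μ m =
  Σ (Fin m → Vertex s l t → ℚ) λ xs →
    (∀ k → IsEigen s l t A μ (xs k)) ×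
    (∀ (c : Fin m → ℚ) → (∀ v → sumFin m (λ k → c k * xs k v) ≡ 0ℚ) → ∀ k → c k ≡ 0ℚ)

IsMain : (s : ℕ) (l t : Fin s → ℕ) → (Vertex s l t → Vertex s l t → ℚ) → ℚ → Set
IsMain s l t A μ = Σ (Vertex s l t → ℚ) λ x → IsEigen s l t A μ x × (sumV s l t x ≢ 0ℚ)

negℕ : ℕ → ℚ
negℕ n = - (+ n / 1)

{-# OPTIONS --safe #-}
module Submission where

-- For two parts U_{i,j} ≠ U_{i,k} of size t_i, x = 𝟙_{U_{i,j}} − 𝟙_{U_{i,k}} has entry sum 0, and the
-- adjacency matrix of a complete multipartite graph is J minus the all-ones blocks on the parts, so
-- A x = −t_i x. Fixing one part j₀ and letting j run over the other l_i − 1 parts gives independent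
-- eigenvectors: each is 1 on its own part and 0 on the parts of the others. Switching about X is conjugation by
-- D = diag(±1), so D x is a −t_i eigenvector of the switched graph, with entry sum
-- (t_i − 2p) − (t_i − 2q) = 2(q − p) ≠ 0.

open import Defs
open import Data.Nat using (ℕ; _<_; _≤_; _∸_)
open import Data.Fin using (Fin; toℕ)
open import Data.Bool using (Bool; true; false; if_then_else_; _xor_; _∧_)
open import Data.Product using (_×_; _,_; Σ-syntax)
open import Relation.Binary.PropositionalEquality
  using (_≡_; _≢_; refl; sym; trans; cong; cong₂; module ≡-Reasoning)

import Data.Nat as ℕ
import Data.Nat.Properties as ℕ
import Data.Fin as F
import Data.Fin.Properties as F
import Data.Integer as ℤ
import Data.Integer.Properties as ℤ
import Data.Nat.Coprimality as Coprime
open import Data.Rational using (ℚ; 0ℚ; 1ℚ; _+_; _*_; -_; _-_; _/_; mkℚ; ↥_)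
open import Data.Rational.Properties
  using ( +-0-monoid; +-0-group; ↥p/↧p≡p; +-identityˡ; +-identityʳ; +-inverseʳ
        ; *-identityˡ; *-identityʳ; *-zeroˡ; *-zeroʳ; *-comm; *-distribˡ-+)
open import Data.Rational.Solver using (module +-*-Solver)
open +-*-Solver
open import Algebra.Properties.Monoid.Mult +-0-monoid using (×-homo-+) renaming (_×_ to _×ℚ_)
open import Algebra.Properties.Group +-0-group using (∙-cancelˡ; x∙y⁻¹≈ε⇒x≈y)
open import Function.Base using (_∘_)
open import Function.Definitions using (Injective)
open import Relation.Nullary.Decidable using (⌊_⌋; isYes≗does; dec-true; dec-false)
open import Relation.Nullary using (Dec; ¬_; yes; no)

fromℕ : ℕ → ℚ
fromℕ n = n ×ℚ 1ℚ

/1≡mkℚ : ∀ n → ℤ.+ n / 1 ≡ mkℚ (ℤ.+ n) 0 (Coprime.sym (Coprime.1-coprimeTo n))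
/1≡mkℚ n = ↥p/↧p≡p (mkℚ (ℤ.+ n) 0 (Coprime.sym (Coprime.1-coprimeTo n)))

/1≡fromℕ : ∀ n → ℤ.+ n / 1 ≡ fromℕ n
/1≡fromℕ ℕ.zero    = refl
-- 1ℚ + mkℚ (+ n) 0 _ computes to (+ 1 ℤ.+ + n ℤ.* + 1) / 1, so only the numerators need matching.
/1≡fromℕ (ℕ.suc n) =
  trans (cong (_/ 1) (cong (λ z → ℤ.+ 1 ℤ.+ z) (sym (ℤ.*-identityʳ (ℤ.+ n)))))
        (cong (λ z → 1ℚ + z) (trans (sym (/1≡mkℚ n)) (/1≡fromℕ n)))

negℕ≡-fromℕ : ∀ n → negℕ n ≡ - fromℕ n
negℕ≡-fromℕ n = cong -_ (/1≡fromℕ n)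

fromℕ-injective : Injective _≡_ _≡_ fromℕ
fromℕ-injective {m} {n} eq = ℤ.+-injective (cong ↥_ (begin
  mkℚ (ℤ.+ m) 0 _  ≡⟨ sym (/1≡mkℚ m) ⟩
  ℤ.+ m / 1        ≡⟨ trans (/1≡fromℕ m) (trans eq (sym (/1≡fromℕ n))) ⟩
  ℤ.+ n / 1        ≡⟨ /1≡mkℚ n ⟩
  mkℚ (ℤ.+ n) 0 _  ∎))
  where open ≡-Reasoning

⌊⌋-true : ∀ {a} {A : Set a} (a? : Dec A) → A → ⌊ a? ⌋ ≡ true
⌊⌋-true a? a = trans (isYes≗does a?) (dec-true a? a)

⌊⌋-false : ∀ {a} {A : Set a} (a? : Dec A) → ¬ A → ⌊ a? ⌋ ≡ false
⌊⌋-false a? ¬a = trans (isYes≗does a?) (dec-false a? ¬a)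

𝟙 : Bool → ℚ
𝟙 true  = 1ℚ
𝟙 false = 0ℚ

sign : Bool → ℚ
sign b = if b then - 1ℚ else 1ℚ

sumFin-cong : ∀ n {f g : Fin n → ℚ} → (∀ a → f a ≡ g a) → sumFin n f ≡ sumFin n g
sumFin-cong ℕ.zero    f≗g = refl
sumFin-cong (ℕ.suc n) f≗g = cong₂ _+_ (f≗g F.zero) (sumFin-cong n (λ a → f≗g (F.suc a)))

sumFin-zero : ∀ n → sumFin n (λ _ → 0ℚ) ≡ 0ℚ
sumFin-zero ℕ.zero    = refl
sumFin-zero (ℕ.suc n) = cong (0ℚ +_) (sumFin-zero n)

sumFin-sub : ∀ n (f g : Fin n → ℚ) → sumFin n (λ a → f a - g a) ≡ sumFin n f - sumFin n g
sumFin-sub ℕ.zero    f g = refl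
sumFin-sub (ℕ.suc n) f g =
  trans (cong ((f F.zero - g F.zero) +_) (sumFin-sub n (λ a → f (F.suc a)) (λ a → g (F.suc a))))
        (solve 4 (λ a b c d → (a :- b) :+ (c :- d) := (a :+ c) :- (b :+ d)) refl
           (f F.zero) (g F.zero) (sumFin n (λ a → f (F.suc a))) (sumFin n (λ a → g (F.suc a))))

sumFin-* : ∀ n c (f : Fin n → ℚ) → sumFin n (λ a → c * f a) ≡ c * sumFin n f
sumFin-* ℕ.zero    c f = sym (*-zeroʳ c)
sumFin-* (ℕ.suc n) c f =
  trans (cong (c * f F.zero +_) (sumFin-* n c (λ a → f (F.suc a))))
        (sym (*-distribˡ-+ c (f F.zero) (sumFin n (λ a → f (F.suc a)))))

sumFin-const : ∀ n c → sumFin n (λ _ → c) ≡ fromℕ n * c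
sumFin-const ℕ.zero    c = sym (*-zeroˡ c)
sumFin-const (ℕ.suc n) c =
  trans (cong (c +_) (sumFin-const n c))
        (solve 2 (λ c m → c :+ m :* c := (con 1ℚ :+ m) :* c) refl c (fromℕ n))

sumFin-single : ∀ n (j : Fin n) (f : Fin n → ℚ) → (∀ a → a ≢ j → f a ≡ 0ℚ) → sumFin n f ≡ f j
sumFin-single (ℕ.suc n) F.zero f f-off =
  trans (cong (f F.zero +_) (trans (sumFin-cong n (λ a → f-off (F.suc a) λ ())) (sumFin-zero n)))
        (+-identityʳ (f F.zero))
sumFin-single (ℕ.suc n) (F.suc j) f f-off =
  trans (cong (_+ sumFin n (λ a → f (F.suc a))) (f-off F.zero λ ()))
        (trans (+-identityˡ _)
               (sumFin-single n j (λ a → f (F.suc a)) (λ a a≢j → f-off (F.suc a) (a≢j ∘ F.suc-injective))))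

sumFin-𝟙false : ∀ n (b : Fin n → Bool) (f : Fin n → ℚ) → (∀ a → b a ≡ false)
              → sumFin n (λ a → 𝟙 (b a) * f a) ≡ 0ℚ
sumFin-𝟙false n b f b≡false =
  trans (sumFin-cong n λ a → trans (cong (λ c → 𝟙 c * f a) (b≡false a)) (*-zeroˡ (f a))) (sumFin-zero n)

sumFin-sign : ∀ n (P : Fin n → Bool)
            → sumFin n (λ a → sign (P a)) + (fromℕ (countFin n P) + fromℕ (countFin n P)) ≡ fromℕ n
sumFin-sign ℕ.zero    P = refl
sumFin-sign (ℕ.suc n) P with P F.zero
... | true  = trans (solve 2 (λ S c → (con (- 1ℚ) :+ S) :+ ((con 1ℚ :+ c) :+ (con 1ℚ :+ c))
                                 := con 1ℚ :+ (S :+ (c :+ c))) refl S c)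
                    (cong (λ z → 1ℚ + z) (sumFin-sign n (λ a → P (F.suc a))))
  where S = sumFin n (λ a → sign (P (F.suc a)))
        c = fromℕ (countFin n (λ a → P (F.suc a)))
... | false = trans (solve 2 (λ S c → (con 1ℚ :+ S) :+ (c :+ c) := con 1ℚ :+ (S :+ (c :+ c))) refl S c)
                    (cong (λ z → 1ℚ + z) (sumFin-sign n (λ a → P (F.suc a))))
  where S = sumFin n (λ a → sign (P (F.suc a)))
        c = fromℕ (countFin n (λ a → P (F.suc a)))

countFin-<⇒sumFin-sign-≢ : ∀ n (P Q : Fin n → Bool) → countFin n Q < countFin n P
                         → sumFin n (λ a → sign (P a)) ≢ sumFin n (λ a → sign (Q a))
countFin-<⇒sumFin-sign-≢ n P Q q<p S≡S = ℕ.<-irrefl (fromℕ-injective doubles) (ℕ.+-mono-< q<p q<p)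
  where
  p = countFin n P
  q = countFin n Q
  doubles : fromℕ (q ℕ.+ q) ≡ fromℕ (p ℕ.+ p)
  doubles = begin
    fromℕ (q ℕ.+ q)      ≡⟨ ×-homo-+ 1ℚ q q ⟩
    fromℕ q + fromℕ q    ≡⟨ ∙-cancelˡ (sumFin n (λ a → sign (Q a))) _ _ (begin
      sumFin n (λ a → sign (Q a)) + (fromℕ q + fromℕ q)  ≡⟨ sumFin-sign n Q ⟩
      fromℕ n                                            ≡⟨ sym (sumFin-sign n P) ⟩
      sumFin n (λ a → sign (P a)) + (fromℕ p + fromℕ p)  ≡⟨ cong (_+ (fromℕ p + fromℕ p)) S≡S ⟩
      sumFin n (λ a → sign (Q a)) + (fromℕ p + fromℕ p)  ∎) ⟩
    fromℕ p + fromℕ p    ≡⟨ sym (×-homo-+ 1ℚ p p) ⟩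
    fromℕ (p ℕ.+ p)      ∎
    where open ≡-Reasoning

dual⇒independent : ∀ {W : Set} m (xs : Fin m → W → ℚ) (w : Fin m → W)
                 → (∀ k → xs k (w k) ≡ 1ℚ) → (∀ k k′ → k′ ≢ k → xs k′ (w k) ≡ 0ℚ)
                 → ∀ (c : Fin m → ℚ) → (∀ v → sumFin m (λ k → c k * xs k v) ≡ 0ℚ) → ∀ k → c k ≡ 0ℚ
dual⇒independent m xs w diagonal offDiagonal c vanishes k = begin
  c k                                    ≡⟨ sym (*-identityʳ (c k)) ⟩
  c k * 1ℚ                               ≡⟨ cong (c k *_) (sym (diagonal k)) ⟩
  c k * xs k (w k)                       ≡⟨ sym (sumFin-single m k _ λ k′ k′≢k →
                                               trans (cong (c k′ *_) (offDiagonal k k′ k′≢k)) (*-zeroʳ (c k′))) ⟩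
  sumFin m (λ k′ → c k′ * xs k′ (w k))   ≡⟨ vanishes (w k) ⟩
  0ℚ                                     ∎
  where open ≡-Reasoning

puncturedEmbedding : ∀ n → 1 ≤ n
                   → Σ[ j₀ ∈ Fin n ] Σ[ e ∈ (Fin (n ∸ 1) → Fin n) ] Injective _≡_ _≡_ e × (∀ k → e k ≢ j₀)
puncturedEmbedding (ℕ.suc n) _ = F.zero , F.suc , F.suc-injective , λ k ()

switching-entry-* : ∀ b c a z → (if b xor c then - a else a) * (sign c * z) ≡ sign b * (a * z)
switching-entry-* true  true  a z = solve 2 (λ a z → a :* (con (- 1ℚ) :* z) := con (- 1ℚ) :* (a :* z)) refl a z
switching-entry-* true  false a z = solve 2 (λ a z → :- a :* (con 1ℚ :* z) := con (- 1ℚ) :* (a :* z)) refl a z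
switching-entry-* false true  a z = solve 2 (λ a z → :- a :* (con (- 1ℚ) :* z) := con 1ℚ :* (a :* z)) refl a z
switching-entry-* false false a z = solve 2 (λ a z → a :* (con 1ℚ :* z) := con 1ℚ :* (a :* z)) refl a z

module _ (s : ℕ) (l t : Fin s → ℕ) where

  V : Set
  V = Vertex s l t

  sumV-cong : {f g : V → ℚ} → (∀ v → f v ≡ g v) → sumV s l t f ≡ sumV s l t g
  sumV-cong f≗g = sumFin-cong s λ i → sumFin-cong (l i) λ j → sumFin-cong (t i) λ a → f≗g (i , j , a)

  sumV-sub : (f g : V → ℚ) → sumV s l t (λ v → f v - g v) ≡ sumV s l t f - sumV s l t g
  sumV-sub f g =
    trans (sumFin-cong s λ i → trans (sumFin-cong (l i) λ j → sumFin-sub (t i) _ _) (sumFin-sub (l i) _ _))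
          (sumFin-sub s _ _)

  sumV-* : ∀ c (f : V → ℚ) → sumV s l t (λ v → c * f v) ≡ c * sumV s l t f
  sumV-* c f =
    trans (sumFin-cong s λ i → trans (sumFin-cong (l i) λ j → sumFin-* (t i) c _) (sumFin-* (l i) c _))
          (sumFin-* s c _)

  inPart : (i : Fin s) → Fin (l i) → V → Bool
  inPart i j (i′ , j′ , _) = ⌊ toℕ i ℕ.≟ toℕ i′ ⌋ ∧ ⌊ toℕ j ℕ.≟ toℕ j′ ⌋

  inPart-self : ∀ i j a → inPart i j (i , j , a) ≡ true
  inPart-self i j a = cong₂ _∧_ (⌊⌋-true (toℕ i ℕ.≟ toℕ i) refl) (⌊⌋-true (toℕ j ℕ.≟ toℕ j) refl)

  inPart-otherClass : ∀ i j i′ j′ a → i ≢ i′ → inPart i j (i′ , j′ , a) ≡ false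
  inPart-otherClass i j i′ j′ a i≢i′ =
    cong (_∧ _) (⌊⌋-false (toℕ i ℕ.≟ toℕ i′) (i≢i′ ∘ F.toℕ-injective))

  inPart-otherPart : ∀ i j j′ a → j ≢ j′ → inPart i j (i , j′ , a) ≡ false
  inPart-otherPart i j j′ a j≢j′ =
    cong₂ _∧_ (⌊⌋-true (toℕ i ℕ.≟ toℕ i) refl)
              (⌊⌋-false (toℕ j ℕ.≟ toℕ j′) (j≢j′ ∘ F.toℕ-injective))

  sumV-inPart-* : ∀ i j (f : V → ℚ)
                → sumV s l t (λ v → 𝟙 (inPart i j v) * f v) ≡ sumFin (t i) (λ a → f (i , j , a))
  sumV-inPart-* i j f = begin
    sumV s l t (λ v → 𝟙 (inPart i j v) * f v)
      ≡⟨ sumFin-single s i _ (λ i′ i′≢i → trans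
           (sumFin-cong (l i′) λ j′ → sumFin-𝟙false (t i′) _ _ λ a →
              inPart-otherClass i j i′ j′ a (λ eq → i′≢i (sym eq)))
           (sumFin-zero (l i′))) ⟩
    sumFin (l i) (λ j′ → sumFin (t i) (λ a → 𝟙 (inPart i j (i , j′ , a)) * f (i , j′ , a)))
      ≡⟨ sumFin-single (l i) j _ (λ j′ j′≢j → sumFin-𝟙false (t i) _ _ λ a →
           inPart-otherPart i j j′ a (λ eq → j′≢j (sym eq))) ⟩
    sumFin (t i) (λ a → 𝟙 (inPart i j (i , j , a)) * f (i , j , a))
      ≡⟨ sumFin-cong (t i) (λ a →
           trans (cong (λ b → 𝟙 b * f (i , j , a)) (inPart-self i j a)) (*-identityˡ (f (i , j , a)))) ⟩
    sumFin (t i) (λ a → f (i , j , a))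
      ∎
    where open ≡-Reasoning

  partDiff : (i : Fin s) → Fin (l i) → Fin (l i) → V → ℚ
  partDiff i j k v = 𝟙 (inPart i j v) - 𝟙 (inPart i k v)

  sumV-partDiff-* : ∀ i j k (f : V → ℚ) → sumV s l t (λ v → partDiff i j k v * f v)
                  ≡ sumFin (t i) (λ a → f (i , j , a)) - sumFin (t i) (λ a → f (i , k , a))
  sumV-partDiff-* i j k f = begin
    sumV s l t (λ v → partDiff i j k v * f v)
      ≡⟨ sumV-cong (λ v → solve 3 (λ x y z → (x :- y) :* z := x :* z :- y :* z) refl
                                   (𝟙 (inPart i j v)) (𝟙 (inPart i k v)) (f v)) ⟩
    sumV s l t (λ v → 𝟙 (inPart i j v) * f v - 𝟙 (inPart i k v) * f v)
      ≡⟨ sumV-sub _ _ ⟩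
    sumV s l t (λ v → 𝟙 (inPart i j v) * f v) - sumV s l t (λ v → 𝟙 (inPart i k v) * f v)
      ≡⟨ cong₂ _-_ (sumV-inPart-* i j f) (sumV-inPart-* i k f) ⟩
    sumFin (t i) (λ a → f (i , j , a)) - sumFin (t i) (λ a → f (i , k , a))
      ∎
    where open ≡-Reasoning

  sumV-partDiff : ∀ i j k → sumV s l t (partDiff i j k) ≡ 0ℚ
  sumV-partDiff i j k =
    trans (sumV-cong λ v → sym (*-identityʳ (partDiff i j k v)))
          (trans (sumV-partDiff-* i j k (λ _ → 1ℚ)) (+-inverseʳ (sumFin (t i) (λ _ → 1ℚ))))

  partDiff-otherClass : ∀ i j k i′ j′ a → i ≢ i′ → partDiff i j k (i′ , j′ , a) ≡ 0ℚ
  partDiff-otherClass i j k i′ j′ a i≢i′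
    rewrite inPart-otherClass i j i′ j′ a i≢i′ | inPart-otherClass i k i′ j′ a i≢i′ = refl

  sumPart-partDiff : ∀ i j k i′ j′ a
                   → sumFin (t i′) (λ b → partDiff i j k (i′ , j′ , b)) ≡ fromℕ (t i) * partDiff i j k (i′ , j′ , a)
  sumPart-partDiff i j k i′ j′ a = trans (sumFin-const (t i′) _) rescale
    where
    rescale : fromℕ (t i′) * partDiff i j k (i′ , j′ , a) ≡ fromℕ (t i) * partDiff i j k (i′ , j′ , a)
    rescale with i F.≟ i′
    ... | yes refl = refl
    ... | no i≢i′ rewrite partDiff-otherClass i j k i′ j′ a i≢i′ =
      trans (*-zeroʳ (fromℕ (t i′))) (sym (*-zeroʳ (fromℕ (t i))))

  adj-row : ∀ i j a (x : V → ℚ) → sumV s l t (λ v → adj s l t (i , j , a) v * x v)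
          ≡ sumV s l t x - sumFin (t i) (λ b → x (i , j , b))
  adj-row i j a x =
    trans (sumV-cong λ v → complement-* (inPart i j v) (x v))
          (trans (sumV-sub _ _) (cong (λ z → sumV s l t x - z) (sumV-inPart-* i j x)))
    where
    complement-* : ∀ b y → (if b then 0ℚ else 1ℚ) * y ≡ y - 𝟙 b * y
    complement-* true  y = solve 1 (λ y → con 0ℚ :* y := y :- con 1ℚ :* y) refl y
    complement-* false y = solve 1 (λ y → con 1ℚ :* y := y :- con 0ℚ :* y) refl y

  partDiff-eigen : ∀ i j k → IsEigen s l t (adj s l t) (negℕ (t i)) (partDiff i j k)
  partDiff-eigen i j k u@(i′ , j′ , a) = begin
    sumV s l t (λ v → adj s l t u v * x v)
      ≡⟨ adj-row i′ j′ a x ⟩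
    sumV s l t x - sumFin (t i′) (λ b → x (i′ , j′ , b))
      ≡⟨ cong₂ _-_ (sumV-partDiff i j k) (sumPart-partDiff i j k i′ j′ a) ⟩
    0ℚ - fromℕ (t i) * x u
      ≡⟨ solve 2 (λ n y → con 0ℚ :- n :* y := (:- n) :* y) refl (fromℕ (t i)) (x u) ⟩
    - fromℕ (t i) * x u
      ≡⟨ cong (_* x u) (sym (negℕ≡-fromℕ (t i))) ⟩
    negℕ (t i) * x u
      ∎
    where
    open ≡-Reasoning
    x = partDiff i j k

  multAtLeast-partDiff : ∀ i m → Fin (t i) → (j₀ : Fin (l i)) (e : Fin m → Fin (l i))
                       → Injective _≡_ _≡_ e → (∀ k → e k ≢ j₀)
                       → MultAtLeast s l t (adj s l t) (negℕ (t i)) m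
  multAtLeast-partDiff i m a j₀ e e-injective e≢j₀ =
    (λ k → partDiff i (e k) j₀) ,
    (λ k → partDiff-eigen i (e k) j₀) ,
    dual⇒independent m _ (λ k → i , e k , a) diagonal offDiagonal
    where
    diagonal : ∀ k → partDiff i (e k) j₀ (i , e k , a) ≡ 1ℚ
    diagonal k rewrite inPart-self i (e k) a | inPart-otherPart i j₀ (e k) a (λ eq → e≢j₀ k (sym eq)) = refl
    offDiagonal : ∀ k k′ → k′ ≢ k → partDiff i (e k′) j₀ (i , e k , a) ≡ 0ℚ
    offDiagonal k k′ k′≢k
      rewrite inPart-otherPart i (e k′) (e k) a (k′≢k ∘ e-injective)
            | inPart-otherPart i j₀ (e k) a (λ eq → e≢j₀ k (sym eq)) = refl

  switching-eigen : ∀ (A : V → V → ℚ) (X : V → Bool) μ x → IsEigen s l t A μ x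
                  → IsEigen s l t (switching A X) μ (λ v → sign (X v) * x v)
  switching-eigen A X μ x eigen u = begin
    sumV s l t (λ v → switching A X u v * (sign (X v) * x v))
      ≡⟨ sumV-cong (λ v → switching-entry-* (X u) (X v) (A u v) (x v)) ⟩
    sumV s l t (λ v → sign (X u) * (A u v * x v))
      ≡⟨ sumV-* (sign (X u)) _ ⟩
    sign (X u) * sumV s l t (λ v → A u v * x v)
      ≡⟨ cong (sign (X u) *_) (eigen u) ⟩
    sign (X u) * (μ * x u)
      ≡⟨ solve 3 (λ d m y → d :* (m :* y) := m :* (d :* y)) refl (sign (X u)) μ (x u) ⟩
    μ * (sign (X u) * x u)
      ∎
    where open ≡-Reasoning

  switched-partDiff-main : ∀ i j k (X : V → Bool)
                         → countFin (t i) (λ a → X (i , k , a)) < countFin (t i) (λ a → X (i , j , a))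
                         → IsMain s l t (switching (adj s l t) X) (negℕ (t i))
  switched-partDiff-main i j k X q<p =
    y , switching-eigen (adj s l t) X (negℕ (t i)) (partDiff i j k) (partDiff-eigen i j k) , sum≢0
    where
    y : V → ℚ
    y v = sign (X v) * partDiff i j k v
    sumV-y : sumV s l t y ≡ sumFin (t i) (λ a → sign (X (i , j , a))) - sumFin (t i) (λ a → sign (X (i , k , a)))
    sumV-y = trans (sumV-cong λ v → *-comm (sign (X v)) (partDiff i j k v))
                   (sumV-partDiff-* i j k (λ v → sign (X v)))
    sum≢0 : sumV s l t y ≢ 0ℚ
    sum≢0 sum≡0 = countFin-<⇒sumFin-sign-≢ (t i) (λ a → X (i , j , a)) (λ a → X (i , k , a)) q<p
                    (x∙y⁻¹≈ε⇒x≈y _ _ (trans (sym sumV-y) sum≡0))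

lemma4p2 : (s : ℕ) (l t : Fin s → ℕ)
    → (∀ (i i' : Fin s) → toℕ i < toℕ i' → t i' < t i)
    → (∀ i → 1 ≤ t i)
    → (∀ i → 1 ≤ l i)
    → (∀ i → MultAtLeast s l t (adj s l t) (negℕ (t i)) (l i ∸ 1))
      × (∀ (i : Fin s) → 2 ≤ l i → (j k : Fin (l i)) → j ≢ k
         → (X : Vertex s l t → Bool)
         → 1 ≤ countFin (t i) (λ a → X (i , j , a))
         → countFin (t i) (λ a → X (i , j , a)) ≤ t i
         → countFin (t i) (λ a → X (i , k , a)) < countFin (t i) (λ a → X (i , j , a))
         → IsMain s l t (switching (adj s l t) X) (negℕ (t i)))
lemma4p2 s l t _ 1≤t 1≤l = multiplicity , λ i _ j k _ X _ _ → switched-partDiff-main s l t i j k X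
  where
  multiplicity : ∀ i → MultAtLeast s l t (adj s l t) (negℕ (t i)) (l i ∸ 1)
  multiplicity i with puncturedEmbedding (l i) (1≤l i)
  ... | j₀ , e , e-injective , e≢j₀ =
    multAtLeast-partDiff s l t i (l i ∸ 1) (F.fromℕ< (1≤t i)) j₀ e e-injective e≢j₀
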